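{- Let $u$ be an aperiodic uniformly recurrent infinite word over the alphabet $\{0,1\}$. Let $w^kw'$ be a factor of $u$, where $w$ is a nonempty finite word, $w'$ is a proper prefix of $w$ (possibly empty) and $k$ is a positive integer. Consider the statements: (P1) $w$ has the maximal index in $u$ among all factors of $u$ of length $|w|$, and $w^kw'$ is the maximal power of $w$ in $u$; (P2) there exist $a,b\in\{0,1\}$ such that $aw^kw'b\in\mathcal L(u)$, $w'b$ is not a prefix of $w$, and $a$ is not a suffix of $w$; (P3) all the factors $w', ww', www',\dots,w^{k-1}w'$ are bispecial in $u$. Then (P1) implies (P2), and (P2) implies (P3).
   Context: $\mathcal L(u)$ is the set of factors of $u$. For a rational $r\geq1$, a word $v$ is the $r$-th power of $w$ if $v=w^{\lfloor r\rfloor}w''$ with $w''$ a proper prefix of $w$ and $r=\lfloor r\rfloor+|w''|/|w|$. For an aperiodic uniformly recurrent word $u$ and a factor $w$, the index of $w$ in $u$ is $\mathrm{ind}(w)=\max\{r\in\mathbb Q: w^r\in\mathcal L(u)\}$, and $w^{\mathrm{ind}(w)}$ is called the maximal power of $w$ in $u$. A factor $x$ is bispecial if $0x,1x,x0,x1\in\mathcal L(u)$. A word $u$ is uniformly recurrent if for every factor $w$, every sufficiently long factor of $u$ contains $w$. -}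

module Defs where

open import Data.Bool using (Bool; true; false)
open import Data.Nat as ℕ using (ℕ; zero; suc; _<_; _≤_; _≥_)
open import Data.Integer using (+_)
open import Data.Rational as ℚ using (ℚ)
open import Data.List using (List; []; _∷_; _++_; length; map; concat; replicate; upTo; [_])
open import Data.Product using (Σ; ∃; ∃-syntax; _×_; _,_)
open import Relation.Binary.PropositionalEquality using (_≡_; _≢_)
open import Relation.Nullary using (¬_)

-- Infinite words over {0,1}: 0 = false, 1 = true.
Word : Set
Word = ℕ → Bool

factorAt : Word → ℕ → ℕ → List Bool
factorAt u i n = map (λ j → u (i ℕ.+ j)) (upTo n)

_∈L_ : List Bool → Word → Set
v ∈L u = ∃[ i ] factorAt u i (length v) ≡ v

Contains : List Bool → List Bool → Set
Contains v w = ∃[ xs ] ∃[ ys ] v ≡ xs ++ w ++ ys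

EventuallyPeriodic : Word → Set
EventuallyPeriodic u = ∃[ p ] ∃[ N ] (0 < p × (∀ n → N ≤ n → u (n ℕ.+ p) ≡ u n))

Aperiodic : Word → Set
Aperiodic u = ¬ EventuallyPeriodic u

UniformlyRecurrent : Word → Set
UniformlyRecurrent u =
  ∀ w → w ∈L u → ∃[ R ] (∀ v → v ∈L u → R ≤ length v → Contains v w)

pow : List Bool → ℕ → List Bool
pow w n = concat (replicate n w)

IsPrefix : List Bool → List Bool → Set
IsPrefix p w = ∃[ z ] p ++ z ≡ w

IsProperPrefix : List Bool → List Bool → Set
IsProperPrefix p w = IsPrefix p w × length p < length w

LetterSuffix : Bool → List Bool → Set
LetterSuffix a w = ∃[ z ] z ++ [ a ] ≡ w

-- the exponent n + |w''|/|w|  (w nonempty; value 0 for empty w, never used)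
expo : List Bool → ℕ → List Bool → ℚ
expo [] n w'' = ℚ.0ℚ
expo (c ∷ cs) n w'' = (+ n) ℚ./ 1 ℚ.+ (+ length w'') ℚ./ length (c ∷ cs)

IsPower : List Bool → List Bool → ℚ → Set
IsPower v w r = w ≢ [] × ∃[ n ] ∃[ w'' ]
  (1 ≤ n × IsProperPrefix w'' w × v ≡ pow w n ++ w'' × r ≡ expo w n w'')

IsIndex : Word → List Bool → ℚ → Set
IsIndex u w r =
  (∃[ v ] (IsPower v w r × v ∈L u)) ×
  (∀ s v → IsPower v w s → v ∈L u → s ℚ.≤ r)

Bispecial : Word → List Bool → Set
Bispecial u x =
  (false ∷ x) ∈L u × (true ∷ x) ∈L u × (x ++ [ false ]) ∈L u × (x ++ [ true ]) ∈L u

P1 : Word → List Bool → ℕ → List Bool → Set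
P1 u w k w' =
  IsIndex u w (expo w k w') ×
  (∀ v s → v ∈L u → length v ≡ length w → IsIndex u v s → s ℚ.≤ expo w k w')

P2 : Word → List Bool → ℕ → List Bool → Set
P2 u w k w' = ∃[ a ] ∃[ b ]
  ((a ∷ (pow w k ++ w' ++ [ b ])) ∈L u ×
   ¬ IsPrefix (w' ++ [ b ]) w ×
   ¬ LetterSuffix a w)

P3 : Word → List Bool → ℕ → List Bool → Set
P3 u w k w' = ∀ i → i < k → Bispecial u (pow w i ++ w')

-- Let X = wᵏw'. Comparing the indices of two words of the same length amounts to comparing
-- the lengths of their maximal powers, so under (P1) every factor of u that is a prefix of a
-- power of w has length at most |X|. Uniform recurrence gives an occurrence aXb of X. If w'b
-- were a prefix of w, Xb would be a longer such factor. If w = za, then aX is a power of the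
-- conjugate az, and dropping the first letter of a power of az leaves a prefix of a power of w;
-- so aX is the maximal power of az, whose index then exceeds that of w.
-- For (P2) ⇒ (P3), each x = wⁱw' with i < k occurs in awᵏw'b preceded by a and by the last letter
-- of w, and followed by b and by the letter that follows w' in w.
module Submission where

open import Defs
open import Data.Bool using (Bool; true; false)
open import Data.Empty using (⊥-elim)
open import Data.Integer as ℤ using (+≤+)
import Data.Integer.Properties as ℤP
open import Data.List
  using (List; []; _∷_; _++_; length; map; upTo; applyUpTo; [_]; initLast; _∷ʳ′_)
open import Data.List.Properties
  using (++-assoc; ++-identityʳ; ∷-injective; length-++; length-++-comm; length-++-≤ˡ;
         length-map; length-upTo; map-upTo; map-applyUpTo; map-cong)
open import Data.Nat using (ℕ; zero; suc; pred; _+_; _*_; _≤_; _<_; z≤n; s≤s; _≤?_)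
open import Data.Nat.Properties
  using (+-identityʳ; +-suc; +-comm; suc-injective; ≤-reflexive; ≤-trans; <⇒≤; ≰⇒>;
         <-irrefl; ≤-<-trans; 1+n≰n; m≤n⇒m≤1+n; m≤n⇒∃[o]m+o≡n; *-monoˡ-≤; *-cancelʳ-≤)
open import Data.Product using (∃-syntax; _×_; _,_; proj₁; proj₂)
open import Data.Rational as ℚ using (ℚ; toℚᵘ)
import Data.Rational.Properties as ℚP
open import Data.Rational.Unnormalised as ℚᵘ using (ℚᵘ; mkℚᵘ; *≡*; *≤*)
import Data.Rational.Unnormalised.Properties as ℚᵘP
open import Data.Sum using (_⊎_; inj₁; inj₂)
open import Function using (_∘_)
open import Relation.Nullary using (¬_; yes; no)
open import Relation.Binary.PropositionalEquality hiding ([_])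
open ≡-Reasoning

length-factorAt : ∀ u i n → length (factorAt u i n) ≡ n
length-factorAt u i n = trans (length-map _ (upTo n)) (length-upTo n)

factorAt-suc : ∀ u i n → factorAt u i (suc n) ≡ u i ∷ factorAt u (suc i) n
factorAt-suc u i n = cong₂ _∷_ (cong u (+-identityʳ i)) (begin
    map at (applyUpTo suc n)   ≡⟨ map-applyUpTo suc at n ⟩
    applyUpTo (at ∘ suc) n     ≡⟨ map-upTo (at ∘ suc) n ⟨
    map (at ∘ suc) (upTo n)    ≡⟨ map-cong (λ j → cong u (+-suc i j)) (upTo n) ⟩
    factorAt u (suc i) n       ∎)
  where
  at : ℕ → Bool
  at j = u (i + j)

factorAt-+ : ∀ u i m n → factorAt u i (m + n) ≡ factorAt u i m ++ factorAt u (i + m) n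
factorAt-+ u i zero n = cong (λ j → factorAt u j n) (sym (+-identityʳ i))
factorAt-+ u i (suc m) n = begin
  factorAt u i (suc m + n)
    ≡⟨ factorAt-suc u i (m + n) ⟩
  u i ∷ factorAt u (suc i) (m + n)
    ≡⟨ cong (u i ∷_) (factorAt-+ u (suc i) m n) ⟩
  u i ∷ factorAt u (suc i) m ++ factorAt u (suc i + m) n
    ≡⟨ cong₂ _++_ (factorAt-suc u i m) (cong (λ j → factorAt u j n) (+-suc i m)) ⟨
  factorAt u i (suc m) ++ factorAt u (i + suc m) n
    ∎

++-injective : ∀ {A : Set} (xs xs' : List A) {ys ys'} → length xs ≡ length xs' →
  xs ++ ys ≡ xs' ++ ys' → xs ≡ xs' × ys ≡ ys'
++-injective [] [] _ eq = refl , eq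
++-injective (x ∷ xs) (x' ∷ xs') len eq with ∷-injective eq
... | refl , eq' with ++-injective xs xs' (suc-injective len) eq'
...   | refl , ys≡ys' = refl , ys≡ys'

factorAt-split : ∀ u i {n} xs ys → factorAt u i n ≡ xs ++ ys →
  factorAt u i (length xs) ≡ xs × factorAt u (i + length xs) (length ys) ≡ ys
factorAt-split u i {n} xs ys eq = ++-injective _ xs (length-factorAt u i (length xs)) (begin
    factorAt u i (length xs) ++ factorAt u (i + length xs) (length ys)
      ≡⟨ factorAt-+ u i (length xs) (length ys) ⟨
    factorAt u i (length xs + length ys)
      ≡⟨ cong (factorAt u i) n≡ ⟨
    factorAt u i n
      ≡⟨ eq ⟩
    xs ++ ys
      ∎)
  where
  n≡ : n ≡ length xs + length ys
  n≡ = trans (sym (length-factorAt u i n)) (trans (cong length eq) (length-++ xs))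

∈L-prefix : ∀ {u v v'} → IsPrefix v v' → v' ∈L u → v ∈L u
∈L-prefix {u} {v} (z , refl) (i , eq) = i , proj₁ (factorAt-split u i v z eq)

∈L-suffix : ∀ {u} xs {v} → (xs ++ v) ∈L u → v ∈L u
∈L-suffix {u} xs {v} (i , eq) = i + length xs , proj₂ (factorAt-split u i xs v eq)

-- Uniform recurrence is only used to find an occurrence of v that is not at position 0.
ur⇒extendable : ∀ {u v} → UniformlyRecurrent u → v ∈L u → ∃[ a ] ∃[ b ] (a ∷ v ++ [ b ]) ∈L u
ur⇒extendable {u} {v} ur v∈L with ur v v∈L
... | R , contains with contains (factorAt u 1 R) (1 , cong (factorAt u 1) (length-factorAt u 1 R))
                                 (≤-reflexive (sym (length-factorAt u 1 R)))
... | xs , ys , eq = u q , b , q , (begin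
    factorAt u q (suc (length (v ++ [ b ])))
      ≡⟨ factorAt-suc u q _ ⟩
    u q ∷ factorAt u (suc q) (length (v ++ [ b ]))
      ≡⟨ cong (λ n → u q ∷ factorAt u (suc q) n) (length-++ v) ⟩
    u q ∷ factorAt u (suc q) (length v + 1)
      ≡⟨ cong (u q ∷_) (factorAt-+ u (suc q) (length v) 1) ⟩
    u q ∷ factorAt u (suc q) (length v) ++ factorAt u (suc q + length v) 1
      ≡⟨ cong₂ (λ t t' → u q ∷ t ++ t') v-at (factorAt-suc u (suc q + length v) 0) ⟩
    u q ∷ v ++ [ b ]
      ∎)
  where
  q : ℕ
  q = length xs
  b : Bool
  b = u (suc q + length v)
  v-at : factorAt u (suc q) (length v) ≡ v
  v-at = proj₁ (factorAt-split u (suc q) v ys (proj₂ (factorAt-split u 1 xs (v ++ ys) eq)))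

prefix-++ : ∀ (v ys : List Bool) → IsPrefix v (v ++ ys)
prefix-++ v ys = ys , refl

prefix-trans : ∀ {v v' v''} → IsPrefix v v' → IsPrefix v' v'' → IsPrefix v v''
prefix-trans {v} (z , refl) (z' , refl) = z ++ z' , sym (++-assoc v z z')

prefix-∷⁺ : ∀ {c v v'} → IsPrefix v v' → IsPrefix (c ∷ v) (c ∷ v')
prefix-∷⁺ (z , eq) = z , cong (_ ∷_) eq

prefix-∷⁻ : ∀ {c d v v'} → IsPrefix (c ∷ v) (d ∷ v') → IsPrefix v v'
prefix-∷⁻ (z , eq) = z , proj₂ (∷-injective eq)

prefix-++ˡ : ∀ xs {v v'} → IsPrefix v v' → IsPrefix (xs ++ v) (xs ++ v')
prefix-++ˡ xs {v} (z , refl) = z , ++-assoc xs v z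

prefix-length : ∀ {v v'} → IsPrefix v v' → length v ≤ length v'
prefix-length {v} (z , refl) = length-++-≤ˡ v

prefix-++-cases : ∀ xs ys v → IsPrefix v (xs ++ ys) →
  IsProperPrefix v xs ⊎ ∃[ v' ] (v ≡ xs ++ v' × IsPrefix v' ys)
prefix-++-cases [] ys v v⊑ys = inj₂ (v , refl , v⊑ys)
prefix-++-cases (x ∷ xs) ys [] _ = inj₁ ((x ∷ xs , refl) , s≤s z≤n)
prefix-++-cases (x ∷ xs) ys (c ∷ v) (z , eq) with ∷-injective eq
... | refl , eq' with prefix-++-cases xs ys v (z , eq')
...   | inj₁ (v⊑xs , v<xs) = inj₁ (prefix-∷⁺ v⊑xs , s≤s v<xs)
...   | inj₂ (v' , refl , v'⊑ys) = inj₂ (v' , refl , v'⊑ys)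

properPrefix-next : ∀ {w' w} → IsProperPrefix w' w → ∃[ c ] IsPrefix (w' ++ [ c ]) w
properPrefix-next {w'} (([] , eq) , w'<w) =
  ⊥-elim (<-irrefl (cong length (trans (sym (++-identityʳ w')) eq)) w'<w)
properPrefix-next {w'} ((c ∷ z , eq) , _) = c , z , trans (++-assoc w' [ c ] z) eq

pow-+ : ∀ w m n → pow w (m + n) ≡ pow w m ++ pow w n
pow-+ w zero n = refl
pow-+ w (suc m) n = trans (cong (w ++_) (pow-+ w m n)) (sym (++-assoc w (pow w m) (pow w n)))

pow-suc : ∀ w n → pow w (suc n) ≡ pow w n ++ w
pow-suc w n = begin
  pow w (suc n)        ≡⟨ cong (pow w) (+-comm 1 n) ⟩
  pow w (n + 1)        ≡⟨ pow-+ w n 1 ⟩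
  pow w n ++ w ++ []   ≡⟨ cong (pow w n ++_) (++-identityʳ w) ⟩
  pow w n ++ w         ∎

length-pow : ∀ w n → length (pow w n) ≡ n * length w
length-pow w zero = refl
length-pow w (suc n) = trans (length-++ w) (cong (length w +_) (length-pow w n))

pow-prefix : ∀ w {m n} → m ≤ n → IsPrefix (pow w m) (pow w n)
pow-prefix w {m} m≤n with m≤n⇒∃[o]m+o≡n m≤n
... | o , refl = pow w o , sym (pow-+ w m o)

pow-suffix : ∀ w {m n} → m ≤ n → ∃[ p ] pow w n ≡ p ++ pow w m
pow-suffix w {m} m≤n with m≤n⇒∃[o]m+o≡n m≤n
... | o , refl = pow w o , trans (cong (pow w) (+-comm m o)) (pow-+ w o m)

prefix-pow-++ : ∀ {w' w} → IsPrefix w' w → ∀ n q → IsPrefix w' (pow w n ++ w' ++ q)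
prefix-pow-++ {w'} w'⊑w zero q = prefix-++ w' q
prefix-pow-++ {w'} {w} w'⊑w (suc n) q =
  subst (IsPrefix w') (sym (++-assoc w (pow w n) (w' ++ q))) (prefix-trans w'⊑w (prefix-++ w _))

prefix-pow-pow : ∀ {w' w i j} q → IsPrefix w' w → i ≤ j →
  IsPrefix (pow w i ++ w') (pow w j ++ w' ++ q)
prefix-pow-pow {w'} {w} {i} q w'⊑w i≤j with m≤n⇒∃[o]m+o≡n i≤j
... | o , refl =
  subst (IsPrefix (pow w i ++ w')) split (prefix-++ˡ (pow w i) (prefix-pow-++ w'⊑w o q))
  where
  split : pow w i ++ pow w o ++ w' ++ q ≡ pow w (i + o) ++ w' ++ q
  split = trans (sym (++-assoc (pow w i) (pow w o) (w' ++ q))) (cong (_++ w' ++ q) (sym (pow-+ w i o)))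

PrefixOfPower : List Bool → List Bool → Set
PrefixOfPower w v = ∃[ n ] IsPrefix v (pow w n)

rotate-pow : ∀ z a n → a ∷ pow (z ++ [ a ]) n ≡ pow (a ∷ z) n ++ [ a ]
rotate-pow z a zero = refl
rotate-pow z a (suc n) = begin
  a ∷ (z ++ [ a ]) ++ pow (z ++ [ a ]) n    ≡⟨ cong (a ∷_) (++-assoc z [ a ] _) ⟩
  a ∷ z ++ a ∷ pow (z ++ [ a ]) n           ≡⟨ cong (λ t → a ∷ z ++ t) (rotate-pow z a n) ⟩
  a ∷ z ++ pow (a ∷ z) n ++ [ a ]           ≡⟨ cong (a ∷_) (++-assoc z (pow (a ∷ z) n) [ a ]) ⟨
  pow (a ∷ z) (suc n) ++ [ a ]              ∎

prefixOfPower-rotate : ∀ z a {v} → PrefixOfPower (z ++ [ a ]) v → PrefixOfPower (a ∷ z) (a ∷ v)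
prefixOfPower-rotate z a (n , v⊑) = suc n , prefix-trans (prefix-∷⁺ v⊑)
  (subst₂ IsPrefix (sym (rotate-pow z a n)) (sym (pow-suc (a ∷ z) n))
    (prefix-++ˡ (pow (a ∷ z) n) (z , refl)))

prefixOfPower-unrotate : ∀ z a {c v} → PrefixOfPower (a ∷ z) (c ∷ v) → PrefixOfPower (z ++ [ a ]) v
prefixOfPower-unrotate z a (n , cv⊑) =
  n , prefix-∷⁻ (subst (IsPrefix _) (sym (rotate-pow z a n)) (prefix-trans cv⊑ (prefix-++ _ [ a ])))

prefix-pow-decompose : ∀ {w} → w ≢ [] → ∀ n {v} → IsPrefix v (pow w n) →
  ∃[ m ] ∃[ w'' ] (v ≡ pow w m ++ w'' × IsProperPrefix w'' w)
prefix-pow-decompose {[]} w≢[] _ _ = ⊥-elim (w≢[] refl)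
prefix-pow-decompose {c ∷ w} _ zero {[]} _ = 0 , [] , refl , (c ∷ w , refl) , s≤s z≤n
prefix-pow-decompose {w} w≢[] (suc n) {v} v⊑ with prefix-++-cases w (pow w n) v v⊑
... | inj₁ v<w = 0 , v , refl , v<w
... | inj₂ (v' , refl , v'⊑) with prefix-pow-decompose w≢[] n v'⊑
...   | m , w'' , refl , w''<w = suc m , w'' , sym (++-assoc w (pow w m) w'') , w''<w

power⇒prefixOfPower : ∀ {v w r} → IsPower v w r → PrefixOfPower w v
power⇒prefixOfPower {w = w} (_ , n , w'' , _ , ((z , w''z≡w) , _) , refl , _) = suc n , z , (begin
  (pow w n ++ w'') ++ z  ≡⟨ ++-assoc (pow w n) w'' z ⟩
  pow w n ++ w'' ++ z    ≡⟨ cong (pow w n ++_) w''z≡w ⟩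
  pow w n ++ w           ≡⟨ pow-suc w n ⟨
  pow w (suc n)          ∎)

power⇒prefix : ∀ {v w r} → IsPower v w r → IsPrefix w v
power⇒prefix {w = w} (_ , suc n , w'' , _ , _ , refl , _) =
  pow w n ++ w'' , sym (++-assoc w (pow w n) w'')

prefixOfPower⇒power : ∀ {w v} → w ≢ [] → PrefixOfPower w v → length w ≤ length v →
  ∃[ r ] IsPower v w r
prefixOfPower⇒power {w} w≢[] (n , v⊑) w≤v with prefix-pow-decompose w≢[] n v⊑
... | zero , w'' , refl , (_ , w''<w) = ⊥-elim (<-irrefl refl (≤-<-trans w≤v w''<w))
... | suc m , w'' , refl , w''<w =
  expo w (suc m) w'' , w≢[] , suc m , w'' , s≤s z≤n , w''<w , refl , refl

mkℚᵘ-mono-≤ : ∀ d {m n} → m ≤ n → mkℚᵘ (ℤ.+ m) d ℚᵘ.≤ mkℚᵘ (ℤ.+ n) d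
mkℚᵘ-mono-≤ d {m} {n} m≤n = *≤* (subst₂ ℤ._≤_ (ℤP.pos-* m (suc d)) (ℤP.pos-* n (suc d))
  (+≤+ (*-monoˡ-≤ (suc d) m≤n)))

mkℚᵘ-cancel-≤ : ∀ d {m n} → mkℚᵘ (ℤ.+ m) d ℚᵘ.≤ mkℚᵘ (ℤ.+ n) d → m ≤ n
mkℚᵘ-cancel-≤ d {m} {n} (*≤* le) = *-cancelʳ-≤ m n (suc d)
  (ℤP.drop‿+≤+ (subst₂ ℤ._≤_ (sym (ℤP.pos-* m (suc d))) (sym (ℤP.pos-* n (suc d))) le))

integer+fraction : ∀ n l d → mkℚᵘ (ℤ.+ n) 0 ℚᵘ.+ mkℚᵘ (ℤ.+ l) d ℚᵘ.≃ mkℚᵘ (ℤ.+ (n * suc d + l)) d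
integer+fraction n l d = *≡* (cong₂ ℤ._*_ numerator (sym denominator))
  where
  numerator : ℚᵘ.↥ (mkℚᵘ (ℤ.+ n) 0 ℚᵘ.+ mkℚᵘ (ℤ.+ l) d) ≡ ℤ.+ (n * suc d + l)
  numerator = trans (cong₂ ℤ._+_ (sym (ℤP.pos-* n (suc d))) (ℤP.*-identityʳ (ℤ.+ l)))
                    (sym (ℤP.pos-+ (n * suc d) l))
  denominator : ℚᵘ.↧ (mkℚᵘ (ℤ.+ n) 0 ℚᵘ.+ mkℚᵘ (ℤ.+ l) d) ≡ ℤ.+ suc d
  denominator = cong (λ x → ℤ.+ suc x) (+-identityʳ d)

expo-≃ : ∀ c w n (w'' : List Bool) →
  toℚᵘ (expo (c ∷ w) n w'') ℚᵘ.≃ mkℚᵘ (ℤ.+ (n * suc (length w) + length w'')) (length w)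
expo-≃ c w n w'' = ℚᵘP.≃-trans (ℚP.toℚᵘ-homo-+ (ℚ.fromℚᵘ integer) (ℚ.fromℚᵘ fraction))
  (ℚᵘP.≃-trans (ℚᵘP.+-cong (ℚP.toℚᵘ-fromℚᵘ integer) (ℚP.toℚᵘ-fromℚᵘ fraction))
               (integer+fraction n (length w'') (length w)))
  where
  integer fraction : ℚᵘ
  integer = mkℚᵘ (ℤ.+ n) 0
  fraction = mkℚᵘ (ℤ.+ length w'') (length w)

-- The exponent of a power v of w is |v| / |w| (mkℚᵘ stores the denominator minus one).
power-exponent : ∀ {v w r} → IsPower v w r → toℚᵘ r ℚᵘ.≃ mkℚᵘ (ℤ.+ length v) (pred (length w))
power-exponent {w = []} (w≢[] , _) = ⊥-elim (w≢[] refl)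
power-exponent {w = c ∷ w} (_ , n , w'' , _ , _ , refl , refl) =
  subst (λ m → toℚᵘ (expo (c ∷ w) n w'') ℚᵘ.≃ mkℚᵘ (ℤ.+ m) (length w)) (sym length-power)
        (expo-≃ c w n w'')
  where
  length-power : length (pow (c ∷ w) n ++ w'') ≡ n * suc (length w) + length w''
  length-power = trans (length-++ (pow (c ∷ w) n)) (cong (_+ length w'') (length-pow (c ∷ w) n))

power-≤⇒length-≤ : ∀ {v w r v' w' r'} → IsPower v w r → IsPower v' w' r' → length w ≡ length w' →
  r ℚ.≤ r' → length v ≤ length v'
power-≤⇒length-≤ {w = w} pv pv' w≡w' r≤r' = mkℚᵘ-cancel-≤ (pred (length w))
  (ℚᵘP.≤-respʳ-≃ (subst (λ n → _ ℚᵘ.≃ mkℚᵘ _ (pred n)) (sym w≡w') (power-exponent pv'))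
    (ℚᵘP.≤-respˡ-≃ (power-exponent pv) (ℚP.toℚᵘ-mono-≤ r≤r')))

length-≤⇒power-≤ : ∀ {v w r v' w' r'} → IsPower v w r → IsPower v' w' r' → length w ≡ length w' →
  length v ≤ length v' → r ℚ.≤ r'
length-≤⇒power-≤ {w = w} pv pv' w≡w' v≤v' = ℚP.toℚᵘ-cancel-≤
  (ℚᵘP.≤-respʳ-≃ (ℚᵘP.≃-sym
      (subst (λ n → _ ℚᵘ.≃ mkℚᵘ _ (pred n)) (sym w≡w') (power-exponent pv')))
    (ℚᵘP.≤-respˡ-≃ (ℚᵘP.≃-sym (power-exponent pv)) (mkℚᵘ-mono-≤ (pred (length w)) v≤v')))

PowersBoundedBy : Word → List Bool → ℕ → Set
PowersBoundedBy u w n = ∀ v → PrefixOfPower w v → v ∈L u → length v ≤ n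

isIndex⇒powersBounded : ∀ {u v w r} → IsIndex u w r → IsPower v w r → PowersBoundedBy u w (length v)
isIndex⇒powersBounded {w = w} (_ , maximal) pv v' v'⊑ v'∈L with length w ≤? length v'
... | yes w≤v' = let s , pv' = prefixOfPower⇒power (proj₁ pv) v'⊑ w≤v'
                 in power-≤⇒length-≤ pv' pv refl (maximal s v' pv' v'∈L)
... | no w≰v' = ≤-trans (<⇒≤ (≰⇒> w≰v')) (prefix-length (power⇒prefix pv))

powersBounded⇒isIndex : ∀ {u v w r} → IsPower v w r → v ∈L u → PowersBoundedBy u w (length v) →
  IsIndex u w r
powersBounded⇒isIndex pv v∈L bounded = (_ , pv , v∈L) , λ s v' pv' v'∈L →
  length-≤⇒power-≤ pv' pv refl (bounded v' (power⇒prefixOfPower pv') v'∈L)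

powersBounded-rotate : ∀ {u} z a {n} → PowersBoundedBy u (z ++ [ a ]) n →
  PowersBoundedBy u (a ∷ z) (suc n)
powersBounded-rotate z a bounded [] _ _ = z≤n
powersBounded-rotate {u} z a bounded (c ∷ v) cv⊑ cv∈L =
  s≤s (bounded v (prefixOfPower-unrotate z a cv⊑) (∈L-suffix {u} [ c ] cv∈L))

IndicesBoundedBy : Word → ℕ → ℚ → Set
IndicesBoundedBy u n r = ∀ v s → v ∈L u → length v ≡ n → IsIndex u v s → s ℚ.≤ r

maximalIndex⇒¬LetterSuffix : ∀ {u w X r a} → IsPower X w r → PowersBoundedBy u w (length X) →
  IndicesBoundedBy u (length w) r → (a ∷ X) ∈L u → ¬ LetterSuffix a w
maximalIndex⇒¬LetterSuffix {u} {X = X} {a = a} pX bounded maximal aX∈L (z , refl) =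
  1+n≰n (power-≤⇒length-≤ paX pX |az|≡|za| (maximal (a ∷ z) r~ az∈L |az|≡|za| index~))
  where
  z⊑X : IsPrefix z X
  z⊑X = prefix-trans (prefix-++ z [ a ]) (power⇒prefix pX)
  |az|≡|za| : length (a ∷ z) ≡ length (z ++ [ a ])
  |az|≡|za| = sym (length-++-comm z [ a ])
  az∈L : (a ∷ z) ∈L u
  az∈L = ∈L-prefix {u} (prefix-∷⁺ z⊑X) aX∈L
  power~ : ∃[ r ] IsPower (a ∷ X) (a ∷ z) r
  power~ = prefixOfPower⇒power (λ ()) (prefixOfPower-rotate z a (power⇒prefixOfPower pX))
                               (s≤s (prefix-length z⊑X))
  r~ : ℚ
  r~ = proj₁ power~
  paX : IsPower (a ∷ X) (a ∷ z) r~
  paX = proj₂ power~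
  index~ : IsIndex u (a ∷ z) r~
  index~ = powersBounded⇒isIndex {u} paX aX∈L (powersBounded-rotate {u} z a bounded)

p1⇒p2 : ∀ {u w w' k} → UniformlyRecurrent u → w ≢ [] → IsProperPrefix w' w → 1 ≤ k →
  (pow w k ++ w') ∈L u → P1 u w k w' → P2 u w k w'
p1⇒p2 {u} {w} {w'} {k} ur w≢[] w'<w k≥1 X∈L (index , maximal)
  with ur⇒extendable {u} {pow w k ++ w'} ur X∈L
... | a , b , aXb∈L = a , b , subst (_∈L u) (cong (a ∷_) (++-assoc (pow w k) w' [ b ])) aXb∈L
                    , w'b⋢w
                    , maximalIndex⇒¬LetterSuffix {u} X-power bounded maximal aX∈L
  where
  X : List Bool
  X = pow w k ++ w'
  aX∈L : (a ∷ X) ∈L u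
  aX∈L = ∈L-prefix {u} (prefix-++ (a ∷ X) [ b ]) aXb∈L
  X-power : IsPower X w (expo w k w')
  X-power = w≢[] , k , w' , k≥1 , w'<w , refl , refl
  bounded : PowersBoundedBy u w (length X)
  bounded = isIndex⇒powersBounded {u} index X-power
  w'b⋢w : ¬ IsPrefix (w' ++ [ b ]) w
  w'b⋢w w'b⊑w = 1+n≰n (subst (_≤ length X) (length-++-comm X [ b ])
    (bounded (X ++ [ b ]) (suc k , Xb⊑w^k+1) (∈L-suffix {u} [ a ] aXb∈L)))
    where
    Xb⊑w^k+1 : IsPrefix (X ++ [ b ]) (pow w (suc k))
    Xb⊑w^k+1 = subst₂ IsPrefix (sym (++-assoc (pow w k) w' [ b ])) (sym (pow-suc w k))
                 (prefix-++ˡ (pow w k) w'b⊑w)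

every-letter : ∀ (P : Bool → Set) {a e} → a ≢ e → P a → P e → ∀ t → P t
every-letter P {false} {false} a≢e _ _ _ = ⊥-elim (a≢e refl)
every-letter P {true} {true} a≢e _ _ _ = ⊥-elim (a≢e refl)
every-letter P {false} {true} _ pa pe false = pa
every-letter P {false} {true} _ pa pe true = pe
every-letter P {true} {false} _ pa pe false = pe
every-letter P {true} {false} _ pa pe true = pa

left-special : ∀ {u w w' a b} m i → i ≤ m → w ≢ [] → IsPrefix w' w → ¬ LetterSuffix a w →
  (a ∷ pow w (suc m) ++ w' ++ [ b ]) ∈L u → ∀ t → (t ∷ pow w i ++ w') ∈L u
left-special {u} {w} {w'} {a} {b} m i i≤m w≢[] w'⊑w a-not-last aTb∈L with initLast w
... | [] = ⊥-elim (w≢[] refl)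
... | y ∷ʳ′ e = every-letter (λ t → (t ∷ x) ∈L u) a≢e ax∈L ex∈L
  where
  x R : List Bool
  x = pow (y ++ [ e ]) i ++ w'
  R = pow (y ++ [ e ]) m ++ w' ++ [ b ]
  a≢e : a ≢ e
  a≢e a≡e = a-not-last (y , cong (λ t → y ++ [ t ]) a≡e)
  ax∈L : (a ∷ x) ∈L u
  ax∈L = ∈L-prefix {u} (prefix-∷⁺ (prefix-pow-pow _ w'⊑w (m≤n⇒m≤1+n i≤m))) aTb∈L
  eR∈L : (e ∷ R) ∈L u
  eR∈L = ∈L-suffix {u} (a ∷ y) (subst (_∈L u)
    (cong (a ∷_) (trans (++-assoc (y ++ [ e ]) _ _) (++-assoc y [ e ] R))) aTb∈L)
  ex∈L : (e ∷ x) ∈L u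
  ex∈L = ∈L-prefix {u} (prefix-∷⁺ (prefix-pow-pow _ w'⊑w i≤m)) eR∈L

right-special : ∀ {u w w' a b c} m i → i ≤ m →
  IsPrefix (w' ++ [ c ]) w → ¬ IsPrefix (w' ++ [ b ]) w →
  (a ∷ pow w (suc m) ++ w' ++ [ b ]) ∈L u → ∀ t → ((pow w i ++ w') ++ [ t ]) ∈L u
right-special {u} {w} {w'} {a} {b} {c} m i i≤m w'c⊑w w'b⋢w aTb∈L =
  every-letter (λ t → ((pow w i ++ w') ++ [ t ]) ∈L u) b≢c xb∈L xc∈L
  where
  T∈L : (pow w (suc m) ++ w' ++ [ b ]) ∈L u
  T∈L = ∈L-suffix {u} [ a ] aTb∈L
  b≢c : b ≢ c
  b≢c refl = w'b⋢w w'c⊑w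
  xc⊑w^i+1 : IsPrefix ((pow w i ++ w') ++ [ c ]) (pow w (suc i))
  xc⊑w^i+1 = subst₂ IsPrefix (sym (++-assoc (pow w i) w' [ c ])) (sym (pow-suc w i))
               (prefix-++ˡ (pow w i) w'c⊑w)
  xc∈L : ((pow w i ++ w') ++ [ c ]) ∈L u
  xc∈L = ∈L-prefix {u} (prefix-trans xc⊑w^i+1 (prefix-trans (pow-prefix w (s≤s i≤m)) (prefix-++ _ _)))
           T∈L
  xb∈L : ((pow w i ++ w') ++ [ b ]) ∈L u
  xb∈L with pow-suffix w (m≤n⇒m≤1+n i≤m)
  ... | p , w^m+1≡pw^i = ∈L-suffix {u} p (subst (_∈L u) (begin
    pow w (suc m) ++ w' ++ [ b ]          ≡⟨ cong (_++ w' ++ [ b ]) w^m+1≡pw^i ⟩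
    (p ++ pow w i) ++ w' ++ [ b ]         ≡⟨ ++-assoc p (pow w i) (w' ++ [ b ]) ⟩
    p ++ pow w i ++ w' ++ [ b ]           ≡⟨ cong (p ++_) (++-assoc (pow w i) w' [ b ]) ⟨
    p ++ (pow w i ++ w') ++ [ b ]         ∎) T∈L)

p2⇒p3 : ∀ {u w w' k} → w ≢ [] → IsProperPrefix w' w → P2 u w k w' → P3 u w k w'
p2⇒p3 {u} {w} {w'} w≢[] w'<w (a , b , aTb∈L , w'b⋢w , a-not-last) i (s≤s {n = m} i≤m)
  with properPrefix-next w'<w
... | c , w'c⊑w = left false , left true , right false , right true
  where
  left : ∀ t → (t ∷ pow w i ++ w') ∈L u
  left = left-special {u} m i i≤m w≢[] (prefix-trans (prefix-++ w' [ c ]) w'c⊑w) a-not-last aTb∈L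
  right : ∀ t → ((pow w i ++ w') ++ [ t ]) ∈L u
  right = right-special {u} m i i≤m w'c⊑w w'b⋢w aTb∈L

mainTheorem2 : (u : Word) → Aperiodic u → UniformlyRecurrent u →
    (w w' : List Bool) (k : ℕ) → w ≢ [] → IsProperPrefix w' w → 1 ≤ k →
    (pow w k ++ w') ∈L u →
    (P1 u w k w' → P2 u w k w') × (P2 u w k w' → P3 u w k w')
mainTheorem2 u _ ur w w' k w≢[] w'<w k≥1 X∈L =
  p1⇒p2 {u} ur w≢[] w'<w k≥1 X∈L , p2⇒p3 {u} w≢[] w'<w
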